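{- Let $G$ be a graph with $n$ vertices. Then $meg(G)=n$ if and only if for every $v\in V(G)$ there exists $u\in N(v)$ such that every induced $2$-path $uvx$ is part of a $4$-cycle (i.e., there is a vertex $w\neq v$ adjacent to both $u$ and $x$).
   Context: All graphs are finite and simple; $N(v)$ is the open neighbourhood of $v$. A pair of vertices $u,v$ (or any vertex set containing them) monitors an edge $e$ if $e$ lies on every shortest $u$–$v$ path. A monitoring edge-geodetic set (MEG-set) of $G$ is a set $M\subseteq V(G)$ such that every edge of $G$ is monitored by some pair of vertices of $M$; $meg(G)$ is the minimum size of an MEG-set. An induced $2$-path is an ordered triple of vertices $u,v,x$ with $u,x$ both adjacent to $v$ and $u$ not adjacent to $x$. -}

module Defs where

open import Data.Nat using (ℕ; zero; suc; _≤_)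
open import Data.Fin using (Fin)
open import Data.Fin.Subset using (Subset; _∈_; ∣_∣)
open import Data.Bool using (Bool; true; false)
open import Data.Product using (Σ; ∃; ∃-syntax; _×_; _,_)
open import Data.Sum using (_⊎_)
open import Data.Empty using (⊥)
open import Relation.Binary.PropositionalEquality using (_≡_; _≢_)
open import Relation.Nullary using (¬_)
open import Function.Bundles using (_⇔_)

record Graph (n : ℕ) : Set where
  field
    adj   : Fin n → Fin n → Bool
    sym   : ∀ u v → adj u v ≡ adj v u
    irrefl : ∀ v → adj v v ≡ false

module _ {n : ℕ} (G : Graph n) where
  open Graph G

  Adj : Fin n → Fin n → Set
  Adj u v = adj u v ≡ true

  data Walk : Fin n → Fin n → Set where
    []   : ∀ {u} → Walk u u
    step : ∀ u {w v} → Adj u w → Walk w v → Walk u v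

  len : ∀ {u v} → Walk u v → ℕ
  len []             = zero
  len (step _ _ p)   = suc (len p)

  EdgeOn : Fin n → Fin n → ∀ {u v} → Walk u v → Set
  EdgeOn a b []                 = ⊥
  EdgeOn a b (step u {w} _ p)   = ((u ≡ a × w ≡ b) ⊎ (u ≡ b × w ≡ a)) ⊎ EdgeOn a b p

  -- a shortest u–v path (a walk of minimum length; such walks are paths)
  Shortest : ∀ {u v} → Walk u v → Set
  Shortest {u} {v} p = ∀ (q : Walk u v) → len p ≤ len q

  -- the pair x,y monitors the edge ab: ab lies on every shortest x–y path
  -- (x and y are required to be connected, so that shortest paths exist)
  Monitors : Fin n → Fin n → Fin n → Fin n → Set
  Monitors x y a b = Walk x y × (∀ (p : Walk x y) → Shortest p → EdgeOn a b p)

  IsMEG : Subset n → Set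
  IsMEG M = ∀ a b → Adj a b → ∃[ x ] ∃[ y ] (x ∈ M × y ∈ M × Monitors x y a b)

  MegIs : ℕ → Set
  MegIs k = (∃[ M ] (IsMEG M × ∣ M ∣ ≡ k)) × (∀ M → IsMEG M → k ≤ ∣ M ∣)

  Induced2Path : Fin n → Fin n → Fin n → Set
  Induced2Path u v x = Adj u v × Adj v x × u ≢ x × ¬ Adj u x

  Condition : Set
  Condition = ∀ v → ∃[ u ] (Adj v u ×
                (∀ x → Induced2Path u v x → ∃[ w ] (w ≢ v × Adj u w × Adj w x)))

-- If no neighbour u of v has the property, each neighbour u lies on an induced 2-path
-- u v x contained in no 4-cycle; then u v x is the only shortest u–x path, so u and x
-- monitor uv and V ∖ {v} is an MEG-set.  Conversely, let v lie outside an MEG-set, with u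
-- as in the condition and uv monitored by x, y ≠ v.  A shortest x–y walk through uv enters
-- and leaves v, once through u and once through some z; as the walk is shortest, u v z is
-- an induced 2-path.  Rerouting the walk through the fourth vertex of a 4-cycle on u v z
-- keeps it shortest but avoids v, so uv was not monitored.
module Submission where

open import Defs
open import Data.Bool using (true)
import Data.Bool as Bool
open import Data.Empty using (⊥-elim)
open import Data.Fin using (Fin; _≟_)
open import Data.Fin.Properties using (any?; all?)
open import Data.Fin.Subset using (Subset; _∈_; ∣_∣; ⊤; ∁; ⁅_⁆)
open import Data.Fin.Subset.Properties
  using (_∈?_; ∈⊤; ∣⊤∣≡n; ∣p∣≡n⇒p≡⊤; ∣p∣≤n; p⊆q⇒∣p∣≤∣q∣; x∈⁅x⁆; x∈p⇒x∉∁p; x∉p⇒x∈∁p; x≢y⇒x∉⁅y⁆)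
open import Data.Nat using (ℕ; zero; suc; _+_; _≤_; _<_; z≤n; s≤s)
open import Data.Nat.Properties
  using (≤-refl; ≤-trans; ≤-antisym; ≤-pred; _≤?_; ≰⇒>; <⇒≱; n≤1+n; n<1+n; +-cancelˡ-≤; +-cancelʳ-≤; +-monoˡ-≤; +-monoʳ-<; module ≤-Reasoning)
open import Data.Product using (Σ; ∃-syntax; _×_; _,_; proj₁)
open import Data.Sum using (_⊎_; inj₁; inj₂)
open import Function using (_∘_)
open import Function.Bundles using (_⇔_; mk⇔)
open import Relation.Binary.PropositionalEquality using (_≡_; _≢_; refl; sym; trans; cong; subst; subst₂; ≢-sym)
open import Relation.Nullary using (¬_; Dec; yes; no; contradiction)
open import Relation.Nullary.Decidable using (_×-dec_; _→-dec_; ¬?; decidable-stable)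

module _ {n : ℕ} (G : Graph n) where

  private variable
    a b c u v w x y z : Fin n

  Adj? : ∀ a b → Dec (Adj G a b)
  Adj? a b = Graph.adj G a b Bool.≟ true

  Adj-sym : Adj G a b → Adj G b a
  Adj-sym {a} {b} h = trans (Graph.sym G b a) h

  Adj⇒≢ : Adj G a b → a ≢ b
  Adj⇒≢ {a} h refl = contradiction (trans (sym h) (Graph.irrefl G a)) λ ()

  infixr 5 _++_

  _++_ : Walk G x y → Walk G y z → Walk G x z
  []           ++ q = q
  step x h p   ++ q = step x h (p ++ q)

  len-++ : (p : Walk G x y) (q : Walk G y z) → len G (p ++ q) ≡ len G p + len G q
  len-++ []           q = refl
  len-++ (step _ _ p) q = cong suc (len-++ p q)

  EdgeOn-sym : (p : Walk G x y) → EdgeOn G a b p → EdgeOn G b a p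
  EdgeOn-sym (step _ _ p) (inj₁ (inj₁ e)) = inj₁ (inj₂ e)
  EdgeOn-sym (step _ _ p) (inj₁ (inj₂ e)) = inj₁ (inj₁ e)
  EdgeOn-sym (step _ _ p) (inj₂ e)        = inj₂ (EdgeOn-sym p e)

  EdgeOn-++⁻ : (p : Walk G x y) (q : Walk G y z) → EdgeOn G a b (p ++ q) → EdgeOn G a b p ⊎ EdgeOn G a b q
  EdgeOn-++⁻ []           q e              = inj₂ e
  EdgeOn-++⁻ (step _ _ p) q (inj₁ e)       = inj₁ (inj₁ e)
  EdgeOn-++⁻ (step _ _ p) q (inj₂ e) with EdgeOn-++⁻ p q e
  ... | inj₁ e′ = inj₁ (inj₂ e′)
  ... | inj₂ e′ = inj₂ e′

  EdgeOn⇒prefix : (p : Walk G x y) → EdgeOn G a b p → Σ (Walk G x a) λ r → len G r ≤ len G p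
  EdgeOn⇒prefix (step _ h p) (inj₁ (inj₁ (refl , refl))) = [] , z≤n
  EdgeOn⇒prefix (step _ h p) (inj₁ (inj₂ (refl , refl))) = step _ h [] , s≤s z≤n
  EdgeOn⇒prefix (step _ h p) (inj₂ e) with EdgeOn⇒prefix p e
  ... | r , r≤p = step _ h r , s≤s r≤p

  EdgeOn⇒suffix : (p : Walk G x y) → EdgeOn G a b p → Σ (Walk G a y) λ r → len G r ≤ len G p
  EdgeOn⇒suffix (step _ h p) (inj₁ (inj₁ (refl , refl))) = step _ h p , ≤-refl
  EdgeOn⇒suffix (step _ h p) (inj₁ (inj₂ (refl , refl))) = p , n≤1+n _
  EdgeOn⇒suffix (step _ h p) (inj₂ e) with EdgeOn⇒suffix p e
  ... | r , r≤p = r , ≤-trans r≤p (n≤1+n _)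

  Shortest-resp-len : {p q : Walk G x y} → len G p ≡ len G q → Shortest G p → Shortest G q
  Shortest-resp-len eq sh r = subst (_≤ len G r) eq (sh r)

  ++-shortestˡ : (p : Walk G x y) (q : Walk G y z) → Shortest G (p ++ q) → Shortest G p
  ++-shortestˡ p q sh r =
    +-cancelʳ-≤ (len G q) _ _ (subst₂ _≤_ (len-++ p q) (len-++ r q) (sh (r ++ q)))

  ++-shortestʳ : (p : Walk G x y) (q : Walk G y z) → Shortest G (p ++ q) → Shortest G q
  ++-shortestʳ p q sh r =
    +-cancelˡ-≤ (len G p) _ _ (subst₂ _≤_ (len-++ p q) (len-++ p r) (sh (p ++ r)))

  shortest⇒¬revisit-start : (h : Adj G x w) (p : Walk G w y) → Shortest G (step x h p) → ¬ EdgeOn G x c p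
  shortest⇒¬revisit-start h p sh e with EdgeOn⇒suffix p e
  ... | r , r≤p = <⇒≱ (sh r) r≤p

  shortest⇒¬visit-ahead : (p : Walk G x a) (h : Adj G a w) (q : Walk G w y) →
                          Shortest G (p ++ step a h q) → ¬ EdgeOn G w c p
  shortest⇒¬visit-ahead p h q sh e with EdgeOn⇒prefix p e
  ... | r , r≤p = <⇒≱ shorter (sh (r ++ q))
    where
    open ≤-Reasoning
    shorter : len G (r ++ q) < len G (p ++ step _ h q)
    shorter = begin-strict
      len G (r ++ q)            ≡⟨ len-++ r q ⟩
      len G r + len G q         ≤⟨ +-monoˡ-≤ (len G q) r≤p ⟩
      len G p + len G q         <⟨ +-monoʳ-< (len G p) (n<1+n (len G q)) ⟩
      len G p + suc (len G q)   ≡⟨ sym (len-++ p _) ⟩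
      len G (p ++ step _ h q)   ∎

  -- A walk of minimum length cannot be computed from the bare definitions; the double
  -- negation suffices because shortest walks are only used to derive a contradiction.
  shortest-exists : Walk G x y → ¬ ¬ Σ (Walk G x y) (Shortest G)
  shortest-exists w = go (len G w) w ≤-refl
    where
    go : ∀ k (w : Walk G x y) → len G w ≤ k → ¬ ¬ Σ (Walk G x y) (Shortest G)
    go zero    w w≤0 none = none (w , λ q → ≤-trans w≤0 z≤n)
    go (suc k) w w≤k none = none (w , minimal)
      where
      minimal : Shortest G w
      minimal q with len G w ≤? len G q
      ... | yes w≤q = w≤q
      ... | no  w≰q = ⊥-elim (go k q (≤-pred (≤-trans (≰⇒> w≰q) w≤k)) none)

  Induced2Path? : ∀ u v x → Dec (Induced2Path G u v x)
  Induced2Path? u v x = Adj? u v ×-dec Adj? v x ×-dec ¬? (u ≟ x) ×-dec ¬? (Adj? u x)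

  Induced2Path-sym : Induced2Path G u v x → Induced2Path G x v u
  Induced2Path-sym (huv , hvx , u≢x , ¬hux) = Adj-sym hvx , Adj-sym huv , ≢-sym u≢x , ¬hux ∘ Adj-sym

  shortest-2-step⇒Induced2Path : (h₁ : Adj G a v) (h₂ : Adj G v b) →
                                 Shortest G (step a h₁ (step v h₂ [])) → Induced2Path G a v b
  shortest-2-step⇒Induced2Path h₁ h₂ sh =
    h₁ , h₂ , (λ { refl → contradiction (sh []) λ () }) , λ h → contradiction (sh (step _ h [])) λ { (s≤s ()) }

  OnFourCycle : Fin n → Fin n → Fin n → Set
  OnFourCycle u v x = ∃[ w ] (w ≢ v × Adj G u w × Adj G w x)

  OnFourCycle? : ∀ u v x → Dec (OnFourCycle u v x)
  OnFourCycle? u v x = any? λ w → ¬? (w ≟ v) ×-dec Adj? u w ×-dec Adj? w x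

  OnFourCycle-sym : OnFourCycle u v x → OnFourCycle x v u
  OnFourCycle-sym (w , w≢v , huw , hwx) = w , w≢v , Adj-sym hwx , Adj-sym huw

  FourCycleNeighbour : Fin n → Fin n → Set
  FourCycleNeighbour v u = Adj G v u × (∀ x → Induced2Path G u v x → OnFourCycle u v x)

  FourCycleNeighbour? : ∀ v u → Dec (FourCycleNeighbour v u)
  FourCycleNeighbour? v u = Adj? v u ×-dec all? λ x → Induced2Path? u v x →-dec OnFourCycle? u v x

  Monitors-swap : Monitors G x y a b → Monitors G x y b a
  Monitors-swap (w , mon) = w , λ p sh → EdgeOn-sym p (mon p sh)

  adjacent-geodesic : Adj G a b → (p : Walk G a b) → len G p ≤ 1 → EdgeOn G a b p
  adjacent-geodesic h []                      _           = ⊥-elim (Adj⇒≢ h refl)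
  adjacent-geodesic h (step _ _ [])           _           = inj₁ (inj₁ (refl , refl))
  adjacent-geodesic h (step _ _ (step _ _ _)) (s≤s ())

  monitors-edge : Adj G a b → Monitors G a b a b
  monitors-edge h = step _ h [] , λ p sh → adjacent-geodesic h p (sh (step _ h []))

  induced-2-path-geodesic : Induced2Path G u v x → ¬ OnFourCycle u v x →
                            (p : Walk G u x) → len G p ≤ 2 → EdgeOn G u v p
  induced-2-path-geodesic (_ , _ , u≢x , _)   _   []              _ = ⊥-elim (u≢x refl)
  induced-2-path-geodesic (_ , _ , _ , ¬hux)  _   (step _ h [])   _ = ⊥-elim (¬hux h)
  induced-2-path-geodesic {v = v} _ ¬square (step _ {w} h₁ (step _ h₂ [])) _ with w ≟ v
  ... | yes refl = inj₁ (inj₁ (refl , refl))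
  ... | no  w≢v  = ⊥-elim (¬square (w , w≢v , h₁ , h₂))
  induced-2-path-geodesic _ _ (step _ _ (step _ _ (step _ _ _))) (s≤s (s≤s ()))

  monitors-induced-2-path : Induced2Path G u v x → ¬ OnFourCycle u v x → Monitors G u x u v
  monitors-induced-2-path i@(huv , hvx , _) ¬square =
    w₀ , λ p sh → induced-2-path-geodesic i ¬square p (sh w₀)
    where
    w₀ = step _ huv (step _ hvx [])

  Split : Walk G x y → Fin n → Fin n → Set
  Split {x} {y} p a b = Σ (Walk G x a) λ p₁ → Σ (Adj G a b) λ h → Σ (Walk G b y) λ p₂ → p₁ ++ step a h p₂ ≡ p

  EdgeOn⇒Split : (p : Walk G x y) → EdgeOn G a b p → Split p a b ⊎ Split p b a
  EdgeOn⇒Split (step _ h p) (inj₁ (inj₁ (refl , refl))) = inj₁ ([] , h , p , refl)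
  EdgeOn⇒Split (step _ h p) (inj₁ (inj₂ (refl , refl))) = inj₂ ([] , h , p , refl)
  EdgeOn⇒Split (step _ h p) (inj₂ e) with EdgeOn⇒Split p e
  ... | inj₁ (p₁ , h′ , p₂ , eq) = inj₁ (step _ h p₁ , h′ , p₂ , cong (step _ h) eq)
  ... | inj₂ (p₁ , h′ , p₂ , eq) = inj₂ (step _ h p₁ , h′ , p₂ , cong (step _ h) eq)

  split-last : (h : Adj G x w) (p : Walk G w v) (r : Walk G v y) →
               Σ (Fin n) λ a → Σ (Walk G x a) λ p′ → Σ (Adj G a v) λ h′ → p′ ++ step a h′ r ≡ step x h p ++ r
  split-last h []            r = _ , [] , h , refl
  split-last h (step _ h₀ p) r with split-last h₀ p r
  ... | a , p′ , h′ , eq = a , step _ h p′ , h′ , cong (step _ h) eq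

  record Passes (p : Walk G x y) (v : Fin n) : Set where
    constructor passes
    field
      {pre post} : Fin n
      before     : Walk G x pre
      into       : Adj G pre v
      out        : Adj G v post
      after      : Walk G post y
      splits     : before ++ step pre into (step v out after) ≡ p

  open Passes

  EdgeOn⇒Passes : x ≢ v → y ≢ v → (p : Walk G x y) → EdgeOn G v u p →
                  Σ (Passes p v) λ π → pre π ≡ u ⊎ post π ≡ u
  EdgeOn⇒Passes x≢v y≢v p e with EdgeOn⇒Split p e
  ... | inj₁ ([] , _ , _ , _) = ⊥-elim (x≢v refl)
  ... | inj₁ (step _ h₀ p₁ , h , p₂ , refl) with split-last h₀ p₁ (step _ h p₂)
  ...   | _ , p₁′ , h₁ , eq = passes p₁′ h₁ h p₂ eq , inj₂ refl
  EdgeOn⇒Passes x≢v y≢v p e | inj₂ (_ , _ , [] , _) = ⊥-elim (y≢v refl)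
  EdgeOn⇒Passes x≢v y≢v p e | inj₂ (p₁ , h , step _ h₂ p₂ , refl) = passes p₁ h h₂ p₂ refl , inj₁ refl

  Passes⇒Induced2Path : {p : Walk G x y} → Shortest G p → (π : Passes p v) → Induced2Path G (pre π) v (post π)
  Passes⇒Induced2Path sh (passes p₁ h₁ h₂ p₂ refl) =
    shortest-2-step⇒Induced2Path h₁ h₂ (++-shortestˡ (step _ h₁ (step _ h₂ [])) p₂ (++-shortestʳ p₁ _ sh))

  detour : {p : Walk G x y} → Shortest G p → (π : Passes p v) → OnFourCycle (pre π) v (post π) →
           Σ (Walk G x y) λ q → Shortest G q × (∀ c → ¬ EdgeOn G v c q)
  detour {v = v} sh (passes {a} {b} p₁ h₁ h₂ p₂ refl) (w , w≢v , h₃ , h₄) =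
    q , Shortest-resp-len (trans (len-++ p₁ _) (sym (len-++ p₁ _))) sh , avoids
    where
    q = p₁ ++ step a h₃ (step w h₄ p₂)
    avoids : ∀ c → ¬ EdgeOn G v c q
    avoids c e with EdgeOn-++⁻ p₁ _ e
    ... | inj₁ e₁                                 = shortest⇒¬visit-ahead p₁ h₁ _ sh e₁
    ... | inj₂ (inj₁ (inj₁ (a≡v , _)))            = Adj⇒≢ h₁ a≡v
    ... | inj₂ (inj₁ (inj₂ (_ , w≡v)))            = w≢v w≡v
    ... | inj₂ (inj₂ (inj₁ (inj₁ (w≡v , _))))     = w≢v w≡v
    ... | inj₂ (inj₂ (inj₁ (inj₂ (_ , b≡v))))     = Adj⇒≢ h₂ (sym b≡v)
    ... | inj₂ (inj₂ (inj₂ e₂))                   =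
      shortest⇒¬revisit-start h₂ p₂ (++-shortestʳ (step a h₁ []) (step v h₂ p₂) (++-shortestʳ p₁ _ sh)) e₂

  FourCycleNeighbour⇒¬Monitors : FourCycleNeighbour v u → x ≢ v → y ≢ v → ¬ Monitors G x y v u
  FourCycleNeighbour⇒¬Monitors {v} {u} (_ , squares) x≢v y≢v (w₀ , mon) =
    shortest-exists w₀ λ (p , sh) →
      let (π , ends)         = EdgeOn⇒Passes x≢v y≢v p (mon p sh)
          (q , shq , avoids) = detour sh π (square ends (Passes⇒Induced2Path sh π))
      in avoids u (mon q shq)
    where
    square : a ≡ u ⊎ b ≡ u → Induced2Path G a v b → OnFourCycle a v b
    square (inj₁ refl) i = squares _ i
    square (inj₂ refl) i = OnFourCycle-sym (squares _ (Induced2Path-sym i))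

  Condition⇒∈MEG : Condition G → {M : Subset n} → IsMEG G M → ∀ v → v ∈ M
  Condition⇒∈MEG cond {M} isMEG v with v ∈? M
  ... | yes v∈M = v∈M
  ... | no  v∉M with cond v
  ...   | u , fcn with isMEG v u (proj₁ fcn)
  ...     | x , y , x∈M , y∈M , mon =
    ⊥-elim (FourCycleNeighbour⇒¬Monitors fcn (λ { refl → v∉M x∈M }) (λ { refl → v∉M y∈M }) mon)

  Condition⇒meg≡n : Condition G → MegIs G n
  Condition⇒meg≡n cond =
    (⊤ , (λ a b h → a , b , ∈⊤ , ∈⊤ , monitors-edge h) , ∣⊤∣≡n n) ,
    λ M isMEG → subst (_≤ ∣ M ∣) (∣⊤∣≡n n) (p⊆q⇒∣p∣≤∣q∣ {p = ⊤} λ {v} _ → Condition⇒∈MEG cond isMEG v)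

  ¬FourCycleNeighbour⇒witness : Adj G v u → ¬ FourCycleNeighbour v u →
                                ∃[ x ] (Induced2Path G u v x × ¬ OnFourCycle u v x)
  ¬FourCycleNeighbour⇒witness {v} {u} hvu ¬fcn
    with any? (λ x → Induced2Path? u v x ×-dec ¬? (OnFourCycle? u v x))
  ... | yes found = found
  ... | no  none  =
    contradiction (hvu , λ x i → decidable-stable (OnFourCycle? u v x) λ ¬sq → none (x , i , ¬sq)) ¬fcn

  ∈∁⁅⁆ : a ≢ v → a ∈ ∁ ⁅ v ⁆
  ∈∁⁅⁆ = x∉p⇒x∈∁p ∘ x≢y⇒x∉⁅y⁆

  punctured-MEG : (∀ u → ¬ FourCycleNeighbour v u) → IsMEG G (∁ ⁅ v ⁆)
  punctured-MEG {v} none a b hab with a ≟ v | b ≟ v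
  ... | no a≢v | no b≢v = a , b , ∈∁⁅⁆ a≢v , ∈∁⁅⁆ b≢v , monitors-edge hab
  ... | yes refl | _ with ¬FourCycleNeighbour⇒witness hab (none b)
  ...   | x , i@(hbv , hvx , _) , ¬square =
    b , x , ∈∁⁅⁆ (Adj⇒≢ hbv) , ∈∁⁅⁆ (Adj⇒≢ (Adj-sym hvx)) , Monitors-swap (monitors-induced-2-path i ¬square)
  punctured-MEG {v} none a b hab | no a≢v | yes refl with ¬FourCycleNeighbour⇒witness (Adj-sym hab) (none a)
  ...   | x , i@(_ , hvx , _) , ¬square =
    a , x , ∈∁⁅⁆ a≢v , ∈∁⁅⁆ (Adj⇒≢ (Adj-sym hvx)) , monitors-induced-2-path i ¬square

  meg≡n⇒Condition : MegIs G n → Condition G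
  meg≡n⇒Condition (_ , minimal) v with any? (FourCycleNeighbour? v)
  ... | yes found = found
  ... | no  none  = contradiction (subst (v ∈_) (sym punctured≡⊤) ∈⊤) (x∈p⇒x∉∁p (x∈⁅x⁆ v))
    where
    punctured≡⊤ : ∁ ⁅ v ⁆ ≡ ⊤
    punctured≡⊤ = ∣p∣≡n⇒p≡⊤ (≤-antisym (∣p∣≤n (∁ ⁅ v ⁆)) (minimal _ (punctured-MEG λ u fcn → none (u , fcn))))

mainTheorem4 : ∀ (n : ℕ) (G : Graph n) → MegIs G n ⇔ Condition G
mainTheorem4 n G = mk⇔ (meg≡n⇒Condition G) (Condition⇒meg≡n G)
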